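{- Let $m$ be a positive integer, $x_1,\dots,x_{m+1}\in V$ pairwise distinct, $\varphi_1,\dots,\varphi_{m+1}\in E$, and assume $H[x_1:\varphi_1,\dots,x_{m+1}:\varphi_{m+1}]$. Let $k=k[x_1:\varphi_1,\dots,x_{m+1}:\varphi_{m+1}]$, $h=k[x_1:\varphi_1,\dots,x_m:\varphi_m]$, and $\varphi\in S(k)$. Then $(\forall)(\{\}(x_{m+1}:\varphi_{m+1},\varphi))\in S(h)$, $(\neg)((\forall)(\{\}(x_{m+1}:\varphi_{m+1},\varphi)))\in S(h)$, $(\neg)(\varphi)\in S(k)$, $(\exists)(\{\}(x_{m+1}:\varphi_{m+1},(\neg)(\varphi)))\in S(h)$, the expressions $\gamma[x_1:\varphi_1,\dots,x_m:\varphi_m,(\neg)((\forall)(\{\}(x_{m+1}:\varphi_{m+1},\varphi)))]$ and $\gamma[x_1:\varphi_1,\dots,x_m:\varphi_m,(\exists)(\{\}(x_{m+1}:\varphi_{m+1},(\neg)(\varphi)))]$ belong to $S(\varepsilon)$, and if the first is true (under $\#$) then so is the second.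
   Context: Language $(V,F,C,\#)$: variables $V$; constants $C$ with meanings $\#(c)$; operator symbols $F$, each $f$ with applicability condition $A_f(x_1,\dots,x_n)$ and value $P_f(x_1,\dots,x_n)$ when applicable; auxiliary symbols $($, $)$, $,$, $:$, $\{\}$; all disjoint and uniquely readable; expressions are strings. $F$ contains $\wedge,\vee,\rightarrow,\leftrightarrow,\neg,\forall,\exists,\in,=$: $A_\wedge,A_\vee,A_\rightarrow,A_\leftrightarrow$ hold exactly on pairs each true or false, $P_\wedge=$ both true, $P_\vee=$ at least one true, $P_\rightarrow=$ "$x_1$ false or $x_2$ true", $P_\leftrightarrow(x_1,x_2)=P_\rightarrow(x_1,x_2)\wedge P_\rightarrow(x_2,x_1)$; $A_\neg$ holds on single objects, $P_\neg(x_1)=$ "$x_1$ false"; $A_\forall,A_\exists$ hold exactly on single sets whose elements are all true or false, $P_\forall=$ every element true, $P_\exists=$ some element true; $A_\in$ holds on pairs with $x_2$ a set, $P_\in=$ "$x_1\in x_2$"; $A_=$ holds on all pairs, $P_==$ "$x_1=x_2$". Soops: finite sequences of ordered pairs; $\varepsilon$ empty, $\|$ concatenation; $\mathrm{dom}$ = set of first components; $\alpha(a)=b$; $\alpha\sqsubseteq\gamma$: initial segment. Simultaneous induction on $n\ge1$: $K(1)=\{\varepsilon\}$, $\Xi(\varepsilon)=\{\varepsilon\}$, $E(1,\varepsilon)=C$, $\#(\varepsilon,c,\varepsilon)=\#(c)$, $V_b(c)=V_f(c)=\emptyset$. $K(n)^+$: all $h\|(y,\varphi)$, $h\in K(n)$,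 $\varphi\in E(n,h)$, $y\in V\setminus\mathrm{dom}(h)$, $\#(h,\varphi,\rho)$ a set for all $\rho$; $K(n+1)=K(n)\cup K(n)^+$; $\Xi(h\|(y,\varphi))=\{\rho\|(y,s):\rho\in\Xi(h),s\in\#(h,\varphi,\rho)\}$. $E(n+1,k)$ is the union of: (0) $E(n,k)$ if $k\in K(n)$; (a) for $k=h\|(y,\varphi)\in K(n)^+$, $t\in E(n,h)$ with $y\notin V_b(t)$, $\#(k,t,\rho\|(y,s))=\#(h,t,\rho)$; (b) for such $k$, $y$ itself, $\#(k,y,\sigma)=\sigma(y)$, $V_f(y)=\{y\}$, $V_b(y)=\emptyset$; (c) for $k\in K(n)$, $(\varphi)(\varphi_1,\dots,\varphi_m)$ with $\varphi,\varphi_i\in E(n,k)$, $\#(k,\varphi,\sigma)$ an $m$-ary function defined at $(\#(k,\varphi_i,\sigma))_i$ for all $\sigma$, meaning its value, $V_b,V_f$ unions; (d) for $k\in K(n)$, $(f)(\varphi_1,\dots,\varphi_m)$, $f\in F$, $\varphi_i\in E(n,k)$, $A_f(\#(k,\varphi_1,\sigma),\dots)$ for all $\sigma$, meaning $P_f(\dots)$, $V_b,V_f$ unions; (e) for $k\in K(n)$, $\{\}(x_1:\varphi_1,\dots,x_m:\varphi_m,\varphi)$, $x_i$ distinct in $V\setminus\mathrm{dom}(k)$, $k'_i=k\|(x_1,\varphi_1)\|\dots\|(x_i,\varphi_i)\in K(n)$, $\varphi_i\in E(n,k'_{i-1})$ with set meanings, $\varphi\in E(n,k'_m)$; meaning $\{\#(k'_m,\varphi,\sigma'):\sigma'\in\Xi(k'_m),\sigma\sqsubseteq\sigma'\}$;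 $V_b=\{x_1,\dots,x_m\}\cup\bigcup V_b(\varphi_i)\cup V_b(\varphi)$; $V_f=V_f(\varphi_1)\cup(V_f(\varphi_2)\setminus\{x_1\})\cup\dots\cup(V_f(\varphi)\setminus\{x_1,\dots,x_m\})$. $K=\bigcup K(n)$, $E(k)=\bigcup_nE(n,k)$, $E=\bigcup_kE(k)$; $S(k)$: $t\in E(k)$ with $\#(k,t,\sigma)$ true or false for all $\sigma\in\Xi(k)$; $\#(t)=\#(\varepsilon,t,\varepsilon)$. $H[x_1:\varphi_1,\dots,x_m:\varphi_m]$ means: with $k_0=\varepsilon$, $k_i=(x_1,\varphi_1)\|\dots\|(x_i,\varphi_i)$, for each $i=1..m$: $k_{i-1}\in K$, $\varphi_i\in E(k_{i-1})$, $\#(k_{i-1},\varphi_i,\rho)$ a set for all $\rho\in\Xi(k_{i-1})$. Then $k[x_1:\varphi_1,\dots,x_m:\varphi_m]=k_m$. For $\varphi\in S(k_m)$: $\gamma[x_m:\varphi_m,\varphi]=(\forall)(\{\}(x_m:\varphi_m,\varphi))$, and $\gamma[x_{i-1}:\varphi_{i-1},\dots,x_m:\varphi_m,\varphi]=(\forall)(\{\}(x_{i-1}:\varphi_{i-1},\gamma[x_i:\varphi_i,\dots,x_m:\varphi_m,\varphi]))$ for $i=m,\dots,2$. -}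

module Defs where

open import Level using (Lift; lift) renaming (suc to lsuc; zero to lzero)
open import Data.Nat using (ℕ; zero; suc)
open import Data.Product using (Σ; Σ-syntax; _×_; _,_; proj₁; proj₂)
open import Data.Sum using (_⊎_; inj₁; inj₂)
open import Data.Empty using (⊥)
open import Data.Unit using (⊤; tt)
open import Data.List using (List; []; _∷_; _++_; _∷ʳ_; map; [_])
open import Data.List.Membership.Propositional using (_∈_; _∉_)
open import Data.List.Relation.Unary.All using (All)
open import Data.List.Relation.Binary.Pointwise using (Pointwise)
open import Relation.Nullary using (¬_; Dec; yes; no)
open import Relation.Binary.PropositionalEquality using (_≡_; _≢_)

-- Objects form a type in Set₁, small set-indexed operations (union of a
-- replacement, singletons) exist, sets are extensional, and the meta-logic
-- is classical (excluded middle), as in the paper's naive set theory.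

record Universe : Set₂ where
  field
    Obj     : Set₁
    _∈ᵒ_    : Obj → Obj → Set₁
    IsSet   : Obj → Set₁
    set-ext : ∀ {a b} → IsSet a → IsSet b →
              (∀ v → v ∈ᵒ a → v ∈ᵒ b) → (∀ v → v ∈ᵒ b → v ∈ᵒ a) → a ≡ b
    -- ⋃ { f v p : v ∈ a }   (replacement followed by union)
    ⋃ʳ      : (a : Obj) → ((v : Obj) → v ∈ᵒ a → Obj) → Obj
    ⋃ʳ-set  : ∀ a f → IsSet (⋃ʳ a f)
    ⋃ʳ-∈    : ∀ a f w → w ∈ᵒ ⋃ʳ a f → Σ Obj λ v → Σ (v ∈ᵒ a) λ p → w ∈ᵒ f v p
    ∈-⋃ʳ    : ∀ a f w v (p : v ∈ᵒ a) → w ∈ᵒ f v p → w ∈ᵒ ⋃ʳ a f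
    sng     : Obj → Obj
    sng-set : ∀ a → IsSet (sng a)
    sng-∈   : ∀ a w → w ∈ᵒ sng a → w ≡ a
    ∈-sng   : ∀ a → a ∈ᵒ sng a
    true false : Obj
    true≢false : true ≢ false
    -- "g is an m-ary function defined at (x₁,…,xₘ)" (m = length of the list)
    -- and its value there
    Defined : Obj → List Obj → Set₁
    apply   : Obj → List Obj → Obj
    lem     : (P : Set₁) → Dec P

-- A language (V, F, C, #) over a universe.  F consists of the nine
-- logical operator symbols plus further symbols F₀.

record Language (U : Universe) : Set₂ where
  open Universe U
  field
    V  : Set
    C  : Set
    #c : C → Obj
    F₀ : Set
    A₀ : F₀ → List Obj → Set₁
    P₀ : F₀ → List Obj → Obj

module Framework (U : Universe) (Lg : Language U) where
  open Universe U
  open Language Lg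

  TF : Obj → Set₁
  TF x = (x ≡ true) ⊎ (x ≡ false)

  fromDec : {Q : Set₁} → Dec Q → Obj
  fromDec (yes _) = true
  fromDec (no _)  = false

  tv : Set₁ → Obj
  tv Q = fromDec (lem Q)

  data Op : Set where
    ∧ᶠ ∨ᶠ →ᶠ ↔ᶠ ¬ᶠ ∀ᶠ ∃ᶠ ∈ᶠ =ᶠ : Op
    other : F₀ → Op

  Pimp : Obj → Obj → Obj
  Pimp x y = tv ((x ≡ false) ⊎ (y ≡ true))

  A : Op → List Obj → Set₁
  A ∧ᶠ (x ∷ y ∷ []) = TF x × TF y
  A ∨ᶠ (x ∷ y ∷ []) = TF x × TF y
  A →ᶠ (x ∷ y ∷ []) = TF x × TF y
  A ↔ᶠ (x ∷ y ∷ []) = TF x × TF y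
  A ¬ᶠ (x ∷ [])     = Lift _ ⊤
  A ∀ᶠ (x ∷ [])     = IsSet x × (∀ y → y ∈ᵒ x → TF y)
  A ∃ᶠ (x ∷ [])     = IsSet x × (∀ y → y ∈ᵒ x → TF y)
  A ∈ᶠ (x ∷ y ∷ []) = IsSet y
  A =ᶠ (x ∷ y ∷ []) = Lift _ ⊤
  A (other f) xs    = A₀ f xs
  A _ _             = Lift _ ⊥

  P : Op → List Obj → Obj
  P ∧ᶠ (x ∷ y ∷ []) = tv ((x ≡ true) × (y ≡ true))
  P ∨ᶠ (x ∷ y ∷ []) = tv ((x ≡ true) ⊎ (y ≡ true))
  P →ᶠ (x ∷ y ∷ []) = Pimp x y
  P ↔ᶠ (x ∷ y ∷ []) = tv ((Pimp x y ≡ true) × (Pimp y x ≡ true))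
  P ¬ᶠ (x ∷ [])     = tv (x ≡ false)
  P ∀ᶠ (x ∷ [])     = tv (∀ y → y ∈ᵒ x → y ≡ true)
  P ∃ᶠ (x ∷ [])     = tv (Σ Obj λ y → (y ∈ᵒ x) × (y ≡ true))
  P ∈ᶠ (x ∷ y ∷ []) = tv (x ∈ᵒ y)
  P =ᶠ (x ∷ y ∷ []) = tv (x ≡ y)
  P (other f) xs    = P₀ f xs
  P _ _             = false   -- irrelevant: A fails here

  -- Expressions, represented by their (uniquely readable) syntax:
  --   con c            ~  c
  --   var x            ~  x
  --   app φ φs         ~  (φ)(φ₁,…,φₘ)
  --   opr f φs         ~  (f)(φ₁,…,φₘ)
  --   cmp bs φ         ~  {}(x₁:φ₁,…,xₘ:φₘ,φ)   with bs = (x₁,φ₁)…(xₘ,φₘ)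
  data Expr : Set where
    con : C → Expr
    var : V → Expr
    app : Expr → List Expr → Expr
    opr : Op → List Expr → Expr
    cmp : List (V × Expr) → Expr → Expr

  mutual
    Vb : Expr → V → Set
    Vb (con c)    z = ⊥
    Vb (var y)    z = ⊥
    Vb (app φ φs) z = Vb φ z ⊎ VbL φs z
    Vb (opr f φs) z = VbL φs z
    Vb (cmp bs φ) z = (z ∈ map proj₁ bs) ⊎ VbB bs z ⊎ Vb φ z

    VbL : List Expr → V → Set
    VbL []       z = ⊥
    VbL (φ ∷ φs) z = Vb φ z ⊎ VbL φs z

    VbB : List (V × Expr) → V → Set
    VbB []             z = ⊥
    VbB ((x , ψ) ∷ bs) z = Vb ψ z ⊎ VbB bs z

  Ctx : Set
  Ctx = List (V × Expr)

  Asg : Set₁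
  Asg = List (V × Obj)

  dom : Ctx → List V
  dom = map proj₁

  _⊑_ : Asg → Asg → Set₁
  σ ⊑ σ' = Σ Asg λ τ → σ' ≡ σ ++ τ

  record Stage : Set₂ where
    field
      K : Ctx → Set₁
      Ξ : Ctx → Asg → Set₁
      E : Ctx → Expr → Set₁
      M : Ctx → Expr → Asg → Obj → Set₁ -- #(k,t,σ) = v

  HoldsAt : (Ctx → Asg → Set₁) → (Ctx → Expr → Asg → Obj → Set₁) →
            Ctx → Expr → (Obj → Set₁) → Set₁
  HoldsAt Ξ' M' k t Q =
    ∀ σ → Ξ' k σ → (Σ Obj λ v → M' k t σ v) × (∀ v → M' k t σ v → Q v)

  data K₁ : Ctx → Set₁ where
    ε : K₁ []
  data Ξ₁ : Ctx → Asg → Set₁ where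
    ε : Ξ₁ [] []
  data E₁ : Ctx → Expr → Set₁ where
    cst : (c : C) → E₁ [] (con c)
  data M₁ : Ctx → Expr → Asg → Obj → Set₁ where
    cst : (c : C) → M₁ [] (con c) [] (#c c)

  stage₁ : Stage
  stage₁ = record { K = K₁ ; Ξ = Ξ₁ ; E = E₁ ; M = M₁ }

  module Step (L : Stage) where
    open Stage L

    Holds : Ctx → Expr → (Obj → Set₁) → Set₁
    Holds = HoldsAt Ξ M

    data Plus (k h : Ctx) (y : V) (φ : Expr) : Set₁ where
      plus : k ≡ h ∷ʳ (y , φ) → K h → E h φ → y ∉ dom h →
             Holds h φ IsSet → Plus k h y φ

    data K⁺ (k : Ctx) : Set₁ where
      old : K k → K⁺ k
      new : ∀ {h y φ} → Plus k h y φ → K⁺ k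

    data Ξ⁺ (k : Ctx) (σ : Asg) : Set₁ where
      old : Ξ k σ → Ξ⁺ k σ
      new : ∀ {h y φ ρ s v} → Plus k h y φ → σ ≡ ρ ∷ʳ (y , s) →
            Ξ h ρ → M h φ ρ v → s ∈ᵒ v → Ξ⁺ k σ

    -- side conditions of rule (e), with k the current context k'_{i-1}
    CmpOK : Ctx → List (V × Expr) → Expr → Set₁
    CmpOK k []             φ = E k φ
    CmpOK k ((x , ψ) ∷ bs) φ =
      (x ∉ dom k) × E k ψ × Holds k ψ IsSet × K (k ∷ʳ (x , ψ)) ×
      CmpOK (k ∷ʳ (x , ψ)) bs φ

    Args : Ctx → Asg → List Expr → List Obj → Set₁
    Args k σ φs vs = Pointwise (λ t v → M k t σ v) φs vs

    data E⁺ : Ctx → Expr → Set₁ where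
      old  : ∀ {k t} → K k → E k t → E⁺ k t
      weak : ∀ {k h y φ t} → Plus k h y φ → E h t → ¬ Vb t y → E⁺ k t
      vr   : ∀ {k h y φ} → Plus k h y φ → E⁺ k (var y)
      ap   : ∀ {k φ φs} → K k → E k φ → All (E k) φs →
             (∀ σ → Ξ k σ → Σ Obj λ g → Σ (List Obj) λ vs →
                M k φ σ g × Args k σ φs vs × Defined g vs) →
             E⁺ k (app φ φs)
      op   : ∀ {k f φs} → K k → All (E k) φs →
             (∀ σ → Ξ k σ → Σ (List Obj) λ vs → Args k σ φs vs × A f vs) →
             E⁺ k (opr f φs)
      cm   : ∀ {k bs φ} → K k → CmpOK k bs φ → E⁺ k (cmp bs φ)

    data M⁺ : Ctx → Expr → Asg → Obj → Set₁ where
      old  : ∀ {k t σ v} → K k → E k t → M k t σ v → M⁺ k t σ v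
      weak : ∀ {k h y φ t σ ρ s v} → Plus k h y φ → E h t → ¬ Vb t y →
             σ ≡ ρ ∷ʳ (y , s) → M h t ρ v → M⁺ k t σ v
      vr   : ∀ {k h y φ σ v} → Plus k h y φ → (y , v) ∈ σ → M⁺ k (var y) σ v
      ap   : ∀ {k φ φs σ g vs} → K k → E k φ → All (E k) φs →
             M k φ σ g → Args k σ φs vs → Defined g vs →
             M⁺ k (app φ φs) σ (apply g vs)
      op   : ∀ {k f φs σ vs} → K k → All (E k) φs →
             Args k σ φs vs → A f vs → M⁺ k (opr f φs) σ (P f vs)
      cm   : ∀ {k bs φ σ w} → K k → CmpOK k bs φ → IsSet w →
             (∀ v → v ∈ᵒ w →
                Σ Asg λ σ' → Ξ (k ++ bs) σ' × σ ⊑ σ' × M (k ++ bs) φ σ' v) →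
             (∀ v σ' → Ξ (k ++ bs) σ' → σ ⊑ σ' → M (k ++ bs) φ σ' v → v ∈ᵒ w) →
             M⁺ k (cmp bs φ) σ w

    next : Stage
    next = record { K = K⁺ ; Ξ = Ξ⁺ ; E = E⁺ ; M = M⁺ }

  -- stage n+1 (stage 0 here is the paper's n = 1)
  stage : ℕ → Stage
  stage zero    = stage₁
  stage (suc n) = Step.next (stage n)

  K : Ctx → Set₁
  K k = Σ ℕ λ n → Stage.K (stage n) k

  Ξ : Ctx → Asg → Set₁
  Ξ k σ = Σ ℕ λ n → Stage.Ξ (stage n) k σ

  E : Ctx → Expr → Set₁
  E k t = Σ ℕ λ n → Stage.E (stage n) k t

  Mean : Ctx → Expr → Asg → Obj → Set₁
  Mean k t σ v = Σ ℕ λ n → Stage.M (stage n) k t σ v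

  Holds : Ctx → Expr → (Obj → Set₁) → Set₁
  Holds = HoldsAt Ξ Mean

  S : Ctx → Expr → Set₁
  S k t = E k t × Holds k t TF

  IsTrue : Expr → Set₁
  IsTrue t = Mean [] t [] true

  HypFrom : Ctx → List (V × Expr) → Set₁
  HypFrom acc []             = Lift _ ⊤
  HypFrom acc ((x , ψ) ∷ bs) =
    K acc × E acc ψ × Holds acc ψ IsSet × HypFrom (acc ∷ʳ (x , ψ)) bs

  H : List (V × Expr) → Set₁
  H bs = HypFrom [] bs

  -- k[x₁:φ₁,…,xₘ:φₘ] is the soop bs itself.

  ¬̇_ : Expr → Expr
  ¬̇ φ = opr ¬ᶠ [ φ ]

  ∀̇_ : Expr → Expr
  ∀̇ φ = opr ∀ᶠ [ φ ]

  ∃̇_ : Expr → Expr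
  ∃̇ φ = opr ∃ᶠ [ φ ]

  -- γ[x₁:φ₁,…,xₘ:φₘ,φ]  (used for m ≥ 1; γ [] φ = φ is only a base case)
  γ : List (V × Expr) → Expr → Expr
  γ []             φ = φ
  γ ((x , ψ) ∷ bs) φ = ∀̇ (cmp [ (x , ψ) ] (γ bs φ))

module Submission where

-- Lemma 5.19: negating a universal statement over the last binder of a
-- context.  The heart of the proof is an adequacy theorem for the stage-wise
-- inductive definition of K, Ξ, E and # in Defs.
--
-- 1. We define a stage-independent denotational semantics `Sem t σ v`
--    ("t denotes v under the assignment σ") by recursion on expressions, and
--    the assignments `Env k σ` generated by a context k.  Sem is functional
--    and depends only on the values of the free variables.
-- 2. Adequacy: for every stage n, σ ∈ Ξₙ(k) iff Env k σ (when k ∈ Kₙ), every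
--    meaning #ₙ(k,t,σ) = v satisfies Sem t σ v, and every t ∈ Eₙ(k) has a
--    meaning at every σ ∈ Ξₙ(k).  Consequently `Holds k t Q` (and hence S(k))
--    can be read off from Sem alone.
-- 3. With this, the logical facts are short: applying ¬ to any expression,
--    or a quantifier ∀/∃ to the comprehension over the last binder of a
--    sentence, yields a sentence; the closure γ preserves sentences and is
--    monotone for truth; and ¬∀x.φ implies ∃x.¬φ by excluded middle.

open import Defs
open import Level using (Lift; lift)
open import Data.Nat using (ℕ; zero; suc; _≤_)
open import Data.Product using (Σ; _×_; _,_; proj₁; proj₂)
open import Data.Sum using (_⊎_; inj₁; inj₂)
open import Data.Empty using (⊥; ⊥-elim)
open import Data.Unit using (tt)
open import Data.Maybe using (Maybe; just; nothing; _<∣>_)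
open import Data.Maybe.Properties using (just-injective; <∣>-assoc; <∣>-identityʳ)
open import Data.List using (List; []; _∷_; _∷ʳ_; map; length; [_]; _++_)
open import Data.List.Properties using (∷ʳ-injective; ∷-injective; ++-assoc; ++-identityʳ; map-++)
open import Data.List.Membership.Propositional using (_∈_)
open import Data.List.Membership.Propositional.Properties using (∈-++⁻; ∈-++⁺ˡ; ∈-++⁺ʳ; ∈-map⁺)
open import Data.List.Relation.Unary.Any using (here)
open import Data.List.Relation.Unary.All using (All; []; _∷_)
open import Data.List.Relation.Binary.Pointwise using (Pointwise; []; _∷_)
open import Data.List.Relation.Unary.Unique.Propositional using (Unique)
open import Relation.Nullary using (¬_; Dec; yes; no)
open import Relation.Binary.PropositionalEquality using (_≡_; _≢_; refl; sym; trans; cong; cong₂; subst)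

module Development (U : Universe) (Lg : Language U) where
  open Universe U
  open Language Lg
  open Framework U Lg
  open Step using (plus; old; new; weak; vr; ap; op; cm)

  Kₙ : ℕ → Ctx → Set₁
  Kₙ n = Stage.K (stage n)

  Ξₙ : ℕ → Ctx → Asg → Set₁
  Ξₙ n = Stage.Ξ (stage n)

  Eₙ : ℕ → Ctx → Expr → Set₁
  Eₙ n = Stage.E (stage n)

  #ₙ : ℕ → Ctx → Expr → Asg → Obj → Set₁
  #ₙ n = Stage.M (stage n)

  Holdsₙ : ℕ → Ctx → Expr → (Obj → Set₁) → Set₁
  Holdsₙ n = HoldsAt (Ξₙ n) (#ₙ n)

  fromDec-true : {Q : Set₁} (d : Dec Q) → fromDec d ≡ true → Q
  fromDec-true (yes q) _ = q
  fromDec-true (no _)  e = ⊥-elim (true≢false (sym e))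

  fromDec-false : {Q : Set₁} (d : Dec Q) → fromDec d ≡ false → ¬ Q
  fromDec-false (yes _) e _ = true≢false e
  fromDec-false (no ¬q) _   = ¬q

  fromDec-intro : {Q : Set₁} (d : Dec Q) → Q → fromDec d ≡ true
  fromDec-intro (yes _) _ = refl
  fromDec-intro (no ¬q) q = ⊥-elim (¬q q)

  fromDec-TF : {Q : Set₁} (d : Dec Q) → TF (fromDec d)
  fromDec-TF (yes _) = inj₁ refl
  fromDec-TF (no _)  = inj₂ refl

  tv-true : {Q : Set₁} → tv Q ≡ true → Q
  tv-true {Q} = fromDec-true (lem Q)

  tv-false : {Q : Set₁} → tv Q ≡ false → ¬ Q
  tv-false {Q} = fromDec-false (lem Q)

  tv-intro : {Q : Set₁} → Q → tv Q ≡ true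
  tv-intro {Q} = fromDec-intro (lem Q)

  tv-TF : (Q : Set₁) → TF (tv Q)
  tv-TF Q = fromDec-TF (lem Q)

  _≟ᵛ_ : (z y : V) → Dec (z ≡ y)
  z ≟ᵛ y with lem (Lift _ (z ≡ y))
  ... | yes (lift p) = yes p
  ... | no ¬p        = no (λ p → ¬p (lift p))

  binding : V → V × Obj → Maybe Obj
  binding z (y , s) with z ≟ᵛ y
  ... | yes _ = just s
  ... | no _  = nothing

  -- The value of the last binding of z in σ: assignments grow at the right,
  -- so later bindings shadow earlier ones.
  lookup : Asg → V → Maybe Obj
  lookup []      z = nothing
  lookup (p ∷ σ) z = lookup σ z <∣> binding z p

  lookup-++ : ∀ σ τ z → lookup (σ ++ τ) z ≡ (lookup τ z <∣> lookup σ z)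
  lookup-++ []      τ z = sym (<∣>-identityʳ (lookup τ z))
  lookup-++ (p ∷ σ) τ z =
    trans (cong (_<∣> binding z p) (lookup-++ σ τ z))
          (<∣>-assoc (lookup τ z) (lookup σ z) (binding z p))

  binding-≢ : ∀ {z y} s → z ≢ y → binding z (y , s) ≡ nothing
  binding-≢ {z} {y} s z≢y with z ≟ᵛ y
  ... | yes z≡y = ⊥-elim (z≢y z≡y)
  ... | no _    = refl

  binding-≡ : ∀ y s → binding y (y , s) ≡ just s
  binding-≡ y s with y ≟ᵛ y
  ... | yes _  = refl
  ... | no y≢y = ⊥-elim (y≢y refl)

  lookup-snoc-≢ : ∀ σ {z y} s → z ≢ y → lookup (σ ∷ʳ (y , s)) z ≡ lookup σ z
  lookup-snoc-≢ σ {z} {y} s z≢y =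
    trans (lookup-++ σ [ (y , s) ] z) (cong (_<∣> lookup σ z) (binding-≢ s z≢y))

  lookup-snoc-≡ : ∀ σ y s → lookup (σ ∷ʳ (y , s)) y ≡ just s
  lookup-snoc-≡ σ y s =
    trans (lookup-++ σ [ (y , s) ] y) (cong (_<∣> lookup σ y) (binding-≡ y s))

  -- Free variables and the denotational semantics

  mutual
    FV : Expr → V → Set
    FV (con c)    z = ⊥
    FV (var y)    z = z ≡ y
    FV (app φ φs) z = FV φ z ⊎ FVs φs z
    FV (opr f φs) z = FVs φs z
    FV (cmp bs φ) z = FVᶜ bs φ z

    FVs : List Expr → V → Set
    FVs []       z = ⊥
    FVs (φ ∷ φs) z = FV φ z ⊎ FVs φs z

    FVᶜ : List (V × Expr) → Expr → V → Set
    FVᶜ []             φ z = FV φ z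
    FVᶜ ((x , ψ) ∷ bs) φ z = FV ψ z ⊎ ((z ≢ x) × FVᶜ bs φ z)

  mutual
    Sem : Expr → Asg → Obj → Set₁
    Sem (con c)    σ v = v ≡ #c c
    Sem (var y)    σ v = lookup σ y ≡ just v
    Sem (app φ φs) σ v =
      Σ Obj λ g → Σ (List Obj) λ vs → Sem φ σ g × Sems φs σ vs × v ≡ apply g vs
    Sem (opr f φs) σ v = Σ (List Obj) λ vs → Sems φs σ vs × v ≡ P f vs
    Sem (cmp bs φ) σ w =
      IsSet w
      × (∀ u → u ∈ᵒ w → Σ Asg λ σ' → Extends bs σ σ' × Sem φ σ' u)
      × (∀ u σ' → Extends bs σ σ' → Sem φ σ' u → u ∈ᵒ w)

    Sems : List Expr → Asg → List Obj → Set₁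
    Sems []       σ vs = vs ≡ []
    Sems (φ ∷ φs) σ vs =
      Σ Obj λ v → Σ (List Obj) λ vs' → vs ≡ v ∷ vs' × Sem φ σ v × Sems φs σ vs'

    Extends : Ctx → Asg → Asg → Set₁
    Extends []            ρ σ = σ ≡ ρ
    Extends ((x , ψ) ∷ k) ρ σ =
      Σ Obj λ a → Sem ψ ρ a × Σ Obj λ s → s ∈ᵒ a × Extends k (ρ ∷ʳ (x , s)) σ

  -- The assignments generated by a context (the semantic Ξ(k)).
  Env : Ctx → Asg → Set₁
  Env k σ = Extends k [] σ

  mutual
    -- Denotations are unique (comprehensions by extensionality).
    sem-functional : ∀ t {σ v v'} → Sem t σ v → Sem t σ v' → v ≡ v'
    sem-functional (con c) p q = trans p (sym q)
    sem-functional (var y) p q = just-injective (trans (sym p) q)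
    sem-functional (app φ φs) (g , vs , sg , svs , refl) (g' , vs' , sg' , svs' , refl)
      with sem-functional φ sg sg' | sems-functional φs svs svs'
    ... | refl | refl = refl
    sem-functional (opr f φs) (vs , svs , refl) (vs' , svs' , refl)
      with sems-functional φs svs svs'
    ... | refl = refl
    sem-functional (cmp bs φ) (w-set , w⊆ , ⊆w) (w'-set , w'⊆ , ⊆w') =
      set-ext w-set w'-set (λ u u∈ → let (σ' , ext , su) = w⊆ u u∈ in ⊆w' u σ' ext su)
                           (λ u u∈ → let (σ' , ext , su) = w'⊆ u u∈ in ⊆w u σ' ext su)

    sems-functional : ∀ φs {σ vs vs'} → Sems φs σ vs → Sems φs σ vs' → vs ≡ vs'
    sems-functional []       p q = trans p (sym q)
    sems-functional (φ ∷ φs) (_ , _ , refl , sv , svs) (_ , _ , refl , sv' , svs') =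
      cong₂ _∷_ (sem-functional φ sv sv') (sems-functional φs svs svs')

  Agree : (V → Set) → Asg → Asg → Set₁
  Agree F σ σ' = ∀ z → F z → lookup σ z ≡ lookup σ' z

  agree-snoc : ∀ x ψ bs φ s {σ σ'} → Agree (FVᶜ ((x , ψ) ∷ bs) φ) σ σ' →
               Agree (FVᶜ bs φ) (σ ∷ʳ (x , s)) (σ' ∷ʳ (x , s))
  agree-snoc x ψ bs φ s {σ} {σ'} ag z fv with z ≟ᵛ x
  ... | yes refl = trans (lookup-snoc-≡ σ x s) (sym (lookup-snoc-≡ σ' x s))
  ... | no z≢x   = trans (lookup-snoc-≢ σ s z≢x)
                         (trans (ag z (inj₂ (z≢x , fv))) (sym (lookup-snoc-≢ σ' s z≢x)))

  mutual
    sem-coincidence : ∀ t {σ σ' v} → Agree (FV t) σ σ' → Sem t σ v → Sem t σ' v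
    sem-coincidence (con c) ag s = s
    sem-coincidence (var y) ag s = trans (sym (ag y refl)) s
    sem-coincidence (app φ φs) ag (g , vs , sg , svs , e) =
      g , vs , sem-coincidence φ (λ z f → ag z (inj₁ f)) sg
             , sems-coincidence φs (λ z f → ag z (inj₂ f)) svs , e
    sem-coincidence (opr f φs) ag (vs , svs , e) = vs , sems-coincidence φs ag svs , e
    sem-coincidence (cmp bs φ) ag (w-set , w⊆ , ⊆w) =
      w-set
      , (λ u u∈ → let (σ₁ , ext₁ , su) = w⊆ u u∈
                      (σ₂ , ext₂ , ag₂) = extends-coincidence bs φ ag ext₁
                  in σ₂ , ext₂ , sem-coincidence φ ag₂ su)
      , (λ u σ₂ ext₂ su →
           let (σ₁ , ext₁ , ag₁) = extends-coincidence bs φ (λ z f → sym (ag z f)) ext₂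
           in ⊆w u σ₁ ext₁ (sem-coincidence φ ag₁ su))

    sems-coincidence : ∀ φs {σ σ' vs} → Agree (FVs φs) σ σ' → Sems φs σ vs → Sems φs σ' vs
    sems-coincidence []       ag s = s
    sems-coincidence (φ ∷ φs) ag (v , vs , e , sv , svs) =
      v , vs , e , sem-coincidence φ (λ z f → ag z (inj₁ f)) sv
                 , sems-coincidence φs (λ z f → ag z (inj₂ f)) svs

    extends-coincidence : ∀ bs φ {σ σ' σ₁} → Agree (FVᶜ bs φ) σ σ' → Extends bs σ σ₁ →
                          Σ Asg λ σ₂ → Extends bs σ' σ₂ × Agree (FV φ) σ₁ σ₂
    extends-coincidence []             φ {σ' = σ'} ag refl = σ' , refl , ag
    extends-coincidence ((x , ψ) ∷ bs) φ {σ} {σ'} ag (a , sa , s , s∈ , ext)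
      with extends-coincidence bs φ (agree-snoc x ψ bs φ s {σ} {σ'} ag) ext
    ... | σ₂ , ext₂ , ag₂ =
      σ₂ , (a , sem-coincidence ψ (λ z f → ag z (inj₁ f)) sa , s , s∈ , ext₂) , ag₂

  extends-shape : ∀ k {ρ σ} → Extends k ρ σ → Σ Asg λ τ → σ ≡ ρ ++ τ × map proj₁ τ ≡ dom k
  extends-shape []            {ρ} refl = [] , sym (++-identityʳ ρ) , refl
  extends-shape ((x , ψ) ∷ k) {ρ} (_ , _ , s , _ , ext) with extends-shape k ext
  ... | τ , refl , d = (x , s) ∷ τ , ++-assoc ρ [ (x , s) ] τ , cong (x ∷_) d

  env-dom : ∀ k {σ} → Env k σ → map proj₁ σ ≡ dom k
  env-dom k env with extends-shape k env
  ... | τ , refl , d = d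

  extends-split : ∀ k₁ k₂ {ρ σ} → Extends (k₁ ++ k₂) ρ σ →
                  Σ Asg λ σ₁ → Extends k₁ ρ σ₁ × Extends k₂ σ₁ σ
  extends-split []             k₂ {ρ} ext = ρ , refl , ext
  extends-split ((x , ψ) ∷ k₁) k₂ (a , sa , s , s∈ , ext) with extends-split k₁ k₂ ext
  ... | σ₁ , ext₁ , ext₂ = σ₁ , (a , sa , s , s∈ , ext₁) , ext₂

  extends-join : ∀ k₁ k₂ {ρ σ₁ σ} → Extends k₁ ρ σ₁ → Extends k₂ σ₁ σ → Extends (k₁ ++ k₂) ρ σ
  extends-join []             k₂ refl ext₂ = ext₂
  extends-join ((x , ψ) ∷ k₁) k₂ (a , sa , s , s∈ , ext₁) ext₂ =
    a , sa , s , s∈ , extends-join k₁ k₂ ext₁ ext₂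

  prefix-unique : ∀ (σ σ₁ τ τ₁ : Asg) → σ ++ τ ≡ σ₁ ++ τ₁ → map proj₁ σ ≡ map proj₁ σ₁ → σ ≡ σ₁
  prefix-unique []      []       _ _ _ _ = refl
  prefix-unique []      (_ ∷ _)  _ _ _ ()
  prefix-unique (_ ∷ _) []       _ _ _ ()
  prefix-unique (a ∷ σ) (_ ∷ σ₁) τ τ₁ e d with ∷-injective e | ∷-injective d
  ... | refl , e' | _ , d' = cong (a ∷_) (prefix-unique σ σ₁ τ τ₁ e' d')

  extends-from-prefix : ∀ k bs {σ σ'} → Env k σ → Env (k ++ bs) σ' → σ ⊑ σ' → Extends bs σ σ'
  extends-from-prefix k bs {σ} env env' (τ , σ'≡) with extends-split k bs env'
  ... | σ₁ , env₁ , ext with extends-shape bs ext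
  ... | τ₁ , σ'≡' , _
    with prefix-unique σ σ₁ τ τ₁ (trans (sym σ'≡) σ'≡') (trans (env-dom k env) (sym (env-dom k env₁)))
  ... | refl = ext

  extends-prefix : ∀ bs {σ σ'} → Extends bs σ σ' → σ ⊑ σ'
  extends-prefix bs ext with extends-shape bs ext
  ... | τ , σ'≡ , _ = τ , σ'≡

  snoc≢[] : ∀ (h : Ctx) p → h ∷ʳ p ≢ []
  snoc≢[] []      p ()
  snoc≢[] (_ ∷ _) p ()

  K₁-empty : ∀ {k} → K₁ k → k ≡ []
  K₁-empty ε = refl

  dom-snoc : ∀ h y (φ : Expr) → dom (h ∷ʳ (y , φ)) ≡ dom h ++ [ y ]
  dom-snoc h y φ = map-++ proj₁ h [ (y , φ) ]

  ∈-dom-snocˡ : ∀ h y (φ : Expr) {z} → z ∈ dom h → z ∈ dom (h ∷ʳ (y , φ))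
  ∈-dom-snocˡ h y φ z∈ = subst (_ ∈_) (sym (dom-snoc h y φ)) (∈-++⁺ˡ z∈)

  ∈-dom-snocʳ : ∀ h y (φ : Expr) → y ∈ dom (h ∷ʳ (y , φ))
  ∈-dom-snocʳ h y φ = subst (y ∈_) (sym (dom-snoc h y φ)) (∈-++⁺ʳ (dom h) (here refl))

  E⇒K : ∀ n {k t} → Eₙ n k t → Kₙ n k
  E⇒K zero    (cst c)        = ε
  E⇒K (suc n) (old kk _)     = old kk
  E⇒K (suc n) (weak p _ _)   = new p
  E⇒K (suc n) (vr p)         = new p
  E⇒K (suc n) (ap kk _ _ _)  = old kk
  E⇒K (suc n) (op kk _ _)    = old kk
  E⇒K (suc n) (cm kk _)      = old kk

  mutual
    free-in-dom : ∀ n {k t z} → Eₙ n k t → FV t z → z ∈ dom k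
    free-in-dom zero    (cst c) ()
    free-in-dom (suc n) (old _ e) fv = free-in-dom n e fv
    free-in-dom (suc n) (weak {h = h} {y} {φ} (plus refl _ _ _ _) e _) fv =
      ∈-dom-snocˡ h y φ (free-in-dom n e fv)
    free-in-dom (suc n) (vr {h = h} {y} {φ} (plus refl _ _ _ _)) refl = ∈-dom-snocʳ h y φ
    free-in-dom (suc n) (ap _ e _ _) (inj₁ fv) = free-in-dom n e fv
    free-in-dom (suc n) (ap _ _ es _) (inj₂ fv) = frees-in-dom n es fv
    free-in-dom (suc n) (op _ es _) fv = frees-in-dom n es fv
    free-in-dom (suc n) (cm {k = k} {bs} {φ} _ ok) fv = cmp-free-in-dom n k bs φ ok fv

    frees-in-dom : ∀ n {k φs z} → All (Eₙ n k) φs → FVs φs z → z ∈ dom k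
    frees-in-dom n (e ∷ _)  (inj₁ fv) = free-in-dom n e fv
    frees-in-dom n (_ ∷ es) (inj₂ fv) = frees-in-dom n es fv

    cmp-free-in-dom : ∀ n k bs φ {z} → Step.CmpOK (stage n) k bs φ → FVᶜ bs φ z → z ∈ dom k
    cmp-free-in-dom n k [] φ e fv = free-in-dom n e fv
    cmp-free-in-dom n k ((x , ψ) ∷ bs) φ (_ , eψ , _ , _ , _) (inj₁ fv) = free-in-dom n eψ fv
    cmp-free-in-dom n k ((x , ψ) ∷ bs) φ {z} (_ , _ , _ , _ , ok) (inj₂ (z≢x , fv))
      with ∈-++⁻ (dom k) (subst (z ∈_) (dom-snoc k x ψ)
                                (cmp-free-in-dom n (k ∷ʳ (x , ψ)) bs φ ok fv))
    ... | inj₁ z∈k        = z∈k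
    ... | inj₂ (here z≡x) = ⊥-elim (z≢x z≡x)

  cmp-body : ∀ n k bs {φ} → Step.CmpOK (stage n) k bs φ → Kₙ n k →
             Kₙ n (k ++ bs) × Eₙ n (k ++ bs) φ
  cmp-body n k [] {φ} e kk =
    subst (Kₙ n) (sym (++-identityʳ k)) kk , subst (λ k' → Eₙ n k' φ) (sym (++-identityʳ k)) e
  cmp-body n k ((x , ψ) ∷ bs) {φ} (_ , _ , _ , kk' , ok) _ with cmp-body n (k ∷ʳ (x , ψ)) bs ok kk'
  ... | kb , eb = subst (Kₙ n) (++-assoc k [ (x , ψ) ] bs) kb
                , subst (λ k' → Eₙ n k' φ) (++-assoc k [ (x , ψ) ] bs) eb

  -- Adequacy of the stage-wise definition with respect to Sem and Env

  mutual
    Ξ⇒Env : ∀ n {k σ} → Ξₙ n k σ → Env k σ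
    Ξ⇒Env zero    ε       = refl
    Ξ⇒Env (suc n) (old ξ) = Ξ⇒Env n ξ
    Ξ⇒Env (suc n) (new {h} {y} {φ} {ρ} {s} {v} (plus refl _ _ _ _) refl ξ m s∈) =
      extends-join h [ (y , φ) ] env (v , sound n m env , s , s∈ , refl)
      where
        env : Env h ρ
        env = Ξ⇒Env n ξ

    Env⇒Ξ : ∀ n {k σ} → Kₙ n k → Env k σ → Ξₙ n k σ
    Env⇒Ξ zero    ε        refl = ε
    Env⇒Ξ (suc n) (old kk) env  = old (Env⇒Ξ n kk env)
    Env⇒Ξ (suc n) (new {h} {y} {φ} (plus refl kh eh y∉ hh)) env
      with extends-split h [ (y , φ) ] env
    ... | ρ , envρ , (a , sa , s , s∈ , refl) with meaning-exists n eh envρ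
    ... | a' , m , sa' with sem-functional φ sa' sa
    ... | refl = new (plus refl kh eh y∉ hh) refl (Env⇒Ξ n kh envρ) m s∈

    sound : ∀ n {k t σ v} → #ₙ n k t σ v → Env k σ → Sem t σ v
    sound zero    (cst c) env = refl
    sound (suc n) (old _ _ m) env = sound n m env
    sound (suc n) (weak {h = h} {y} {φ} {t} {ρ = ρ} {s} (plus refl _ _ y∉ _) et _ refl m) env
      with extends-split h [ (y , φ) ] env
    ... | ρ' , envρ , (_ , _ , _ , _ , ρ∷ʳ≡) with ∷ʳ-injective ρ ρ' ρ∷ʳ≡
    ... | refl , refl = sem-coincidence t agree (sound n m envρ)
      where
        -- y is not free in t, since the free variables of t are declared in h.
        agree : Agree (FV t) ρ (ρ ∷ʳ (y , s))
        agree z fv =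
          sym (lookup-snoc-≢ ρ s (λ z≡y → y∉ (subst (_∈ dom h) z≡y (free-in-dom n et fv))))
    sound (suc n) (vr {h = h} {y} {φ} {v = v} (plus refl _ _ y∉ _) yv∈) env
      with extends-split h [ (y , φ) ] env
    ... | ρ , envρ , (_ , _ , _ , _ , refl) with ∈-++⁻ ρ yv∈
    ... | inj₁ yv∈ρ       = ⊥-elim (y∉ (subst (y ∈_) (env-dom h envρ) (∈-map⁺ proj₁ yv∈ρ)))
    ... | inj₂ (here refl) = lookup-snoc-≡ ρ y v
    sound (suc n) (ap {g = g} {vs = vs} _ _ _ m args _) env =
      g , vs , sound n m env , sound-args n args env , refl
    sound (suc n) (op {vs = vs} _ _ args _) env = vs , sound-args n args env , refl
    sound (suc n) (cm {k = k} {bs} {φ} {σ} {w} kk ok w-set w⊆ ⊆w) env =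
      w-set
      , (λ u u∈ → let (σ' , ξ' , σ⊑σ' , m) = w⊆ u u∈
                      env' = Ξ⇒Env n ξ'
                  in σ' , extends-from-prefix k bs env env' σ⊑σ' , sound n m env')
      , (λ u σ' ext su → let env' = extends-join k bs env ext
                             (u' , m , su') = meaning-exists n (proj₂ body) env'
                         in subst (_∈ᵒ w) (sem-functional φ su' su)
                              (⊆w u' σ' (Env⇒Ξ n (proj₁ body) env') (extends-prefix bs ext) m))
      where
        body : Kₙ n (k ++ bs) × Eₙ n (k ++ bs) φ
        body = cmp-body n k bs ok kk

    sound-args : ∀ n {k σ φs vs} → Pointwise (λ t v → #ₙ n k t σ v) φs vs → Env k σ → Sems φs σ vs
    sound-args n []       env = refl
    sound-args n (m ∷ ms) env = _ , _ , refl , sound n m env , sound-args n ms env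

    meaning : ∀ n {k t σ} → Eₙ n k t → Ξₙ n k σ → Σ Obj λ v → #ₙ n k t σ v
    meaning zero (cst c) ε = #c c , cst c
    meaning (suc n) (old kk e) ξ =
      let (v , m) = meaning n e (Env⇒Ξ n kk (Ξ⇒Env (suc n) ξ)) in v , old kk e m
    meaning (suc n) (weak {h = h} {y} {φ} (plus refl kh eh y∉ hh) e y∉t) ξ
      with extends-split h [ (y , φ) ] (Ξ⇒Env (suc n) ξ)
    ... | ρ , envρ , (_ , _ , _ , _ , refl) =
      let (v , m) = meaning n e (Env⇒Ξ n kh envρ) in v , weak (plus refl kh eh y∉ hh) e y∉t refl m
    meaning (suc n) (vr {h = h} {y} {φ} p@(plus refl _ _ _ _)) ξ
      with extends-split h [ (y , φ) ] (Ξ⇒Env (suc n) ξ)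
    ... | ρ , _ , (_ , _ , s , _ , refl) = s , vr p (∈-++⁺ʳ ρ (here refl))
    meaning (suc n) (ap kk e es defined) ξ =
      let (g , vs , m , args , d) = defined _ (Env⇒Ξ n kk (Ξ⇒Env (suc n) ξ))
      in apply g vs , ap kk e es m args d
    meaning (suc n) (op kk es applicable) ξ =
      let (vs , args , a) = applicable _ (Env⇒Ξ n kk (Ξ⇒Env (suc n) ξ)) in _ , op kk es args a
    meaning (suc n) (cm {k = k} {bs} {φ} kk ok) ξ =
      let env = Ξ⇒Env (suc n) ξ
          (w , sw) = cmp-denotation n k bs φ ok env
      in w , cmp-meaning n kk ok env sw

    meaning-exists : ∀ n {k t σ} → Eₙ n k t → Env k σ → Σ Obj λ v → #ₙ n k t σ v × Sem t σ v
    meaning-exists n e env =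
      let (v , m) = meaning n e (Env⇒Ξ n (E⇒K n e) env) in v , m , sound n m env

    cmp-meaning : ∀ n {k bs φ σ w} → Kₙ n k → Step.CmpOK (stage n) k bs φ → Env k σ →
                  Sem (cmp bs φ) σ w → #ₙ (suc n) k (cmp bs φ) σ w
    cmp-meaning n {k} {bs} {φ} {σ} {w} kk ok env (w-set , w⊆ , ⊆w) = cm kk ok w-set
      (λ u u∈ → let (σ' , ext , su) = w⊆ u u∈
                    env' = extends-join k bs env ext
                    (u' , m , su') = meaning-exists n (proj₂ body) env'
                in σ' , Env⇒Ξ n (proj₁ body) env' , extends-prefix bs ext
                      , subst (#ₙ n (k ++ bs) φ σ') (sem-functional φ su' su) m)
      (λ u σ' ξ' σ⊑σ' m → let env' = Ξ⇒Env n ξ'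
                          in ⊆w u σ' (extends-from-prefix k bs env env' σ⊑σ') (sound n m env'))
      where
        body : Kₙ n (k ++ bs) × Eₙ n (k ++ bs) φ
        body = cmp-body n k bs ok kk

    -- A well-formed comprehension denotes a set: iterated unions of
    -- singletons, one union per binder.
    cmp-denotation : ∀ n k bs φ {σ} → Step.CmpOK (stage n) k bs φ → Env k σ →
                     Σ Obj λ w → Sem (cmp bs φ) σ w
    cmp-denotation n k [] φ {σ} e env with meaning-exists n e env
    ... | v , _ , sv = sng v , sng-set v
      , (λ u u∈ → σ , refl , subst (Sem φ σ) (sym (sng-∈ v u u∈)) sv)
      , (λ { u .σ refl su → subst (_∈ᵒ sng v) (sem-functional φ sv su) (∈-sng v) })
    cmp-denotation n k ((x , ψ) ∷ bs) φ {σ} (_ , eψ , _ , _ , ok) env with meaning-exists n eψ env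
    ... | a , _ , sa = ⋃ʳ a inner , ⋃ʳ-set a inner
      , (λ u u∈ → let (s , s∈ , u∈') = ⋃ʳ-∈ a inner u u∈
                      (σ' , ext , su) = proj₁ (proj₂ (proj₂ (inner-sem s s∈))) u u∈'
                  in σ' , (a , sa , s , s∈ , ext) , su)
      , (λ { u σ' (a' , sa' , s , s∈ , ext) su → ⊆⋃ u σ' a' sa' s s∈ ext su })
      where
        inner-sem : ∀ s → s ∈ᵒ a → Σ Obj λ w → Sem (cmp bs φ) (σ ∷ʳ (x , s)) w
        inner-sem s s∈ = cmp-denotation n (k ∷ʳ (x , ψ)) bs φ ok
                           (extends-join k [ (x , ψ) ] env (a , sa , s , s∈ , refl))
        inner : (s : Obj) → s ∈ᵒ a → Obj
        inner s s∈ = proj₁ (inner-sem s s∈)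
        ⊆⋃ : ∀ u σ' a' → Sem ψ σ a' → ∀ s → s ∈ᵒ a' → Extends bs (σ ∷ʳ (x , s)) σ' →
             Sem φ σ' u → u ∈ᵒ ⋃ʳ a inner
        ⊆⋃ u σ' a' sa' s s∈ ext su with sem-functional ψ sa sa'
        ... | refl = ∈-⋃ʳ a inner u s s∈ (proj₂ (proj₂ (proj₂ (inner-sem s s∈))) u σ' ext su)

  denotation : ∀ {k t σ} → E k t → Env k σ → Σ Obj λ v → Sem t σ v
  denotation (n , e) env = let (v , _ , sv) = meaning-exists n e env in v , sv

  holds-from-sem : ∀ {k t} {Q : Obj → Set₁} → E k t →
                   (∀ σ v → Env k σ → Sem t σ v → Q v) → Holds k t Q
  holds-from-sem (n , e) Q-sem σ (m , ξ) =
    let env = Ξ⇒Env m ξ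
        (v , mv , _) = meaning-exists n e env
    in (v , (n , mv)) , λ v' (n' , mv') → Q-sem σ v' env (sound n' mv' env)

  sem-from-holds : ∀ {k t} {Q : Obj → Set₁} → E k t → Holds k t Q →
                   ∀ σ v → Env k σ → Sem t σ v → Q v
  sem-from-holds {t = t} {Q} (n , e) holds σ v env sv =
    let (v' , m , sv') = meaning-exists n e env
    in subst Q (sem-functional t sv' sv) (proj₂ (holds σ (n , Env⇒Ξ n (E⇒K n e) env)) v' (n , m))

  sem-from-true : ∀ {t} → IsTrue t → Sem t [] true
  sem-from-true (n , m) = sound n m refl

  true-from-sem : ∀ {t} → E [] t → Sem t [] true → IsTrue t
  true-from-sem {t} (n , e) s-true =
    let (v , m , sv) = meaning-exists n e refl
    in n , subst (#ₙ n [] t []) (sem-functional t sv s-true) m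

  -- Expressions, Holds-facts and instances of the rule K(n)⁺ persist to the
  -- next stage; for Holds this uses soundness, since meanings may be re-derived.
  E-next : ∀ n {k t} → Eₙ n k t → Eₙ (suc n) k t
  E-next n e = old (E⇒K n e) e

  holds-next : ∀ n {k t} {Q : Obj → Set₁} → Eₙ n k t → Holdsₙ n k t Q → Holdsₙ (suc n) k t Q
  holds-next n {t = t} {Q} e holds σ ξ =
    let env = Ξ⇒Env (suc n) ξ
        ((v , m) , Q-all) = holds σ (Env⇒Ξ n (E⇒K n e) env)
    in (v , old (E⇒K n e) e m)
       , λ v' m' → subst Q (sem-functional t (sound n m env) (sound (suc n) m' env)) (Q-all v m)

  Plus-next : ∀ n {k h y φ} → Step.Plus (stage n) k h y φ → Step.Plus (stage (suc n)) k h y φ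
  Plus-next n (plus k≡ kh eφ y∉ φ-set) = plus k≡ (old kh) (E-next n eφ) y∉ (holds-next n eφ φ-set)

  plus-inversion : ∀ n {h y φ} → Kₙ (suc n) (h ∷ʳ (y , φ)) → Step.Plus (stage n) (h ∷ʳ (y , φ)) h y φ
  plus-inversion zero    {h} (old kk) = ⊥-elim (snoc≢[] h _ (K₁-empty kk))
  plus-inversion (suc n)     (old kk) = Plus-next n (plus-inversion n kk)
  plus-inversion n       {h} (new {h'} p@(plus k≡ _ _ _ _)) with ∷ʳ-injective h h' k≡
  ... | refl , refl = p

  operand : ∀ f t {σ v} → Sem (opr f [ t ]) σ v → Σ Obj λ w → Sem t σ w × v ≡ P f [ w ]
  operand f t (_ , (w , _ , refl , sw , refl) , refl) = w , sw , refl

  apply-operator : ∀ f t {σ w} → Sem t σ w → Sem (opr f [ t ]) σ (P f [ w ])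
  apply-operator f t {w = w} sw = [ w ] , (w , [] , refl , sw , refl) , refl

  ∀-true-elim : ∀ t {σ} → Sem (∀̇ t) σ true → Σ Obj λ w → Sem t σ w × (∀ y → y ∈ᵒ w → y ≡ true)
  ∀-true-elim t s with operand ∀ᶠ t s
  ... | w , sw , e = w , sw , tv-true (sym e)

  ∀-true-intro : ∀ t {σ w} → Sem t σ w → (∀ y → y ∈ᵒ w → y ≡ true) → Sem (∀̇ t) σ true
  ∀-true-intro t {σ} sw all-true = subst (Sem (∀̇ t) σ) (tv-intro all-true) (apply-operator ∀ᶠ t sw)

  ∃-true-intro : ∀ t {σ w} → Sem t σ w → true ∈ᵒ w → Sem (∃̇ t) σ true
  ∃-true-intro t {σ} sw true∈ =
    subst (Sem (∃̇ t) σ) (tv-intro (true , true∈ , refl)) (apply-operator ∃ᶠ t sw)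

  ¬-true-elim : ∀ t {σ} → Sem (¬̇ t) σ true → Sem t σ false
  ¬-true-elim t {σ} s with operand ¬ᶠ t s
  ... | w , sw , e = subst (Sem t σ) (tv-true (sym e)) sw

  ¬-true-intro : ∀ t {σ} → Sem t σ false → Sem (¬̇ t) σ true
  ¬-true-intro t {σ} sf = subst (Sem (¬̇ t) σ) (tv-intro refl) (apply-operator ¬ᶠ t sf)

  -- Sentences built with ¬, quantifiers and γ

  record Quantifier (f : Op) : Set₁ where
    field
      applicable   : ∀ w → IsSet w → (∀ y → y ∈ᵒ w → TF y) → A f [ w ]
      truth-valued : ∀ w → TF (P f [ w ])

  ∀-quantifier : Quantifier ∀ᶠ
  ∀-quantifier = record { applicable = λ _ w-set tf → w-set , tf ; truth-valued = λ _ → tv-TF _ }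

  ∃-quantifier : Quantifier ∃ᶠ
  ∃-quantifier = record { applicable = λ _ w-set tf → w-set , tf ; truth-valued = λ _ → tv-TF _ }

  quantify-S : ∀ {f} → Quantifier f → ∀ h x ψ φ →
               S (h ∷ʳ (x , ψ)) φ → S h (opr f [ cmp [ (x , ψ) ] φ ])
  quantify-S q h x ψ φ ((zero , eφ) , _) = ⊥-elim (snoc≢[] h _ (K₁-empty (E⇒K zero eφ)))
  quantify-S {f} q h x ψ φ ((suc n , eφ) , φ-TF) with Plus-next n (plus-inversion n (E⇒K (suc n) eφ))
  ... | plus _ kh eψ x∉ ψ-set = (suc (suc (suc n)) , eQ) , holds-from-sem (suc (suc (suc n)) , eQ) truth
    where
      open Quantifier q
      Cφ : Expr
      Cφ = cmp [ (x , ψ) ] φ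
      eC : Eₙ (suc (suc n)) h Cφ
      eC = cm kh (x∉ , eψ , ψ-set , E⇒K (suc n) eφ , eφ)
      -- The elements of the comprehension are values of the sentence φ.
      elements-TF : ∀ σ w → Env h σ → Sem Cφ σ w → ∀ y → y ∈ᵒ w → TF y
      elements-TF σ w env (_ , w⊆ , _) y y∈ =
        let (σ' , ext , sy) = w⊆ y y∈
        in sem-from-holds (suc n , eφ) φ-TF σ' y (extends-join h [ (x , ψ) ] env ext) sy
      eQ : Eₙ (suc (suc (suc n))) h (opr f [ Cφ ])
      eQ = op (old kh) (eC ∷ []) λ σ ξ →
        let env = Ξ⇒Env (suc (suc n)) ξ
            (w , m , sw) = meaning-exists (suc (suc n)) eC env
        in [ w ] , m ∷ [] , applicable w (proj₁ sw) (elements-TF σ w env sw)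
      truth : ∀ σ v → Env h σ → Sem (opr f [ Cφ ]) σ v → TF v
      truth σ v _ s with operand f Cφ s
      ... | w , _ , refl = truth-valued w

  negate-S : ∀ {k t} → E k t → S k (¬̇ t)
  negate-S {k} {t} (n , e) = (suc n , e¬) , holds-from-sem (suc n , e¬) truth
    where
      e¬ : Eₙ (suc n) k (¬̇ t)
      e¬ = op (E⇒K n e) (e ∷ []) λ σ ξ → let (v , m) = meaning n e ξ in [ v ] , m ∷ [] , lift tt
      truth : ∀ σ v → Env k σ → Sem (¬̇ t) σ v → TF v
      truth σ v _ s with operand ¬ᶠ t s
      ... | w , _ , refl = tv-TF _

  ++-snoc : ∀ (acc : Ctx) b bs → acc ++ (b ∷ bs) ≡ (acc ∷ʳ b) ++ bs
  ++-snoc acc b bs = sym (++-assoc acc [ b ] bs)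

  γ-S : ∀ acc bs χ → S (acc ++ bs) χ → S acc (γ bs χ)
  γ-S acc []             χ s = subst (λ k → S k χ) (++-identityʳ acc) s
  γ-S acc ((x , ψ) ∷ bs) χ s =
    quantify-S ∀-quantifier acc x ψ (γ bs χ)
      (γ-S (acc ∷ʳ (x , ψ)) bs χ (subst (λ k → S k χ) (++-snoc acc (x , ψ) bs) s))

  γ-monotone : ∀ acc bs χ₁ χ₂ → S (acc ++ bs) χ₁ → S (acc ++ bs) χ₂ →
               (∀ σ → Env (acc ++ bs) σ → Sem χ₁ σ true → Sem χ₂ σ true) →
               ∀ ρ → Env acc ρ → Sem (γ bs χ₁) ρ true → Sem (γ bs χ₂) ρ true
  γ-monotone acc [] χ₁ χ₂ _ _ entails ρ env =
    entails ρ (subst (λ k → Env k ρ) (sym (++-identityʳ acc)) env)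
  γ-monotone acc ((x , ψ) ∷ bs) χ₁ χ₂ s₁ s₂ entails ρ env γχ₁-true
    with ∀-true-elim (cmp [ (x , ψ) ] (γ bs χ₁)) γχ₁-true
       | denotation (proj₁ (γ-S acc ((x , ψ) ∷ bs) χ₂ s₂)) env
  ... | w₁ , (_ , _ , ⊆w₁) , all-true₁ | _ , s∀₂ with operand ∀ᶠ (cmp [ (x , ψ) ] (γ bs χ₂)) s∀₂
  ... | w₂ , sw₂@(_ , w₂⊆ , _) , _ = ∀-true-intro (cmp [ (x , ψ) ] (γ bs χ₂)) sw₂ all-true₂
    where
      acc' : Ctx
      acc' = acc ∷ʳ (x , ψ)
      shift : ∀ {χ} → S (acc ++ ((x , ψ) ∷ bs)) χ → S (acc' ++ bs) χ
      shift {χ} = subst (λ k → S k χ) (++-snoc acc (x , ψ) bs)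
      entails' : ∀ σ → Env (acc' ++ bs) σ → Sem χ₁ σ true → Sem χ₂ σ true
      entails' σ env' = entails σ (subst (λ k → Env k σ) (sym (++-snoc acc (x , ψ) bs)) env')
      -- Each element of w₂ is the value of γ[bs, χ₂] at an extension σ' of ρ;
      -- there γ[bs, χ₁] is an element of w₁, hence true, so by induction so is γ[bs, χ₂].
      all-true₂ : ∀ y → y ∈ᵒ w₂ → y ≡ true
      all-true₂ y y∈ =
        let (σ' , ext , sy) = w₂⊆ y y∈
            env' = extends-join acc [ (x , ψ) ] env ext
            (y₁ , sy₁) = denotation (proj₁ (γ-S acc' bs χ₁ (shift s₁))) env'
            sy₁-true = subst (Sem (γ bs χ₁) σ') (all-true₁ y₁ (⊆w₁ y₁ σ' ext sy₁)) sy₁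
        in sem-functional (γ bs χ₂) sy
             (γ-monotone acc' bs χ₁ χ₂ (shift s₁) (shift s₂) entails' σ' env' sy₁-true)

  -- ¬∀x.φ entails ∃x.¬φ: by excluded middle, either some instance of φ is
  -- false, or all instances are true (they are truth values), contradicting ¬∀.
  ¬∀⇒∃¬ : ∀ h x ψ φ → S (h ∷ʳ (x , ψ)) φ → E h (∃̇ (cmp [ (x , ψ) ] (¬̇ φ))) →
          ∀ σ → Env h σ → Sem (¬̇ (∀̇ (cmp [ (x , ψ) ] φ))) σ true →
          Sem (∃̇ (cmp [ (x , ψ) ] (¬̇ φ))) σ true
  ¬∀⇒∃¬ h x ψ φ (eφ , φ-TF) e∃ σ env ¬∀-true
    with operand ∀ᶠ (cmp [ (x , ψ) ] φ) (¬-true-elim (∀̇ (cmp [ (x , ψ) ] φ)) ¬∀-true)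
       | denotation e∃ env
  ... | w , (_ , w⊆ , _) , ∀-false | _ , s∃ with operand ∃ᶠ (cmp [ (x , ψ) ] (¬̇ φ)) s∃
  ... | w' , sw'@(_ , _ , ⊆w') , _ with lem (Σ Obj λ y → y ∈ᵒ w × y ≡ false)
  ... | yes (y , y∈ , refl) =
    let (σ' , ext , sφ) = w⊆ y y∈
    in ∃-true-intro (cmp [ (x , ψ) ] (¬̇ φ)) sw' (⊆w' true σ' ext (¬-true-intro φ sφ))
  ... | no no-false = ⊥-elim (tv-false (sym ∀-false) all-true)
    where
      all-true : ∀ y → y ∈ᵒ w → y ≡ true
      all-true y y∈ with w⊆ y y∈
      ... | σ' , ext , sy with sem-from-holds eφ φ-TF σ' y (extends-join h [ (x , ψ) ] env ext) sy
      ... | inj₁ y≡true  = y≡true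
      ... | inj₂ y≡false = ⊥-elim (no-false (y , y∈ , y≡false))

lemma5p19 : (U : Universe) (Lg : Language U) →
    let open Language Lg
        open Framework U Lg
    in (m : ℕ) → 1 ≤ m →
       (bs : List (V × Expr)) → length bs ≡ m →
       (x : V) (ψ : Expr) →
       Unique (map proj₁ (bs ∷ʳ (x , ψ))) →
       All (λ b → Σ Ctx (λ k → E k (proj₂ b))) (bs ∷ʳ (x , ψ)) →
       H (bs ∷ʳ (x , ψ)) →
       (φ : Expr) → S (bs ∷ʳ (x , ψ)) φ →
       S bs (∀̇ (cmp [ (x , ψ) ] φ))
       × S bs (¬̇ (∀̇ (cmp [ (x , ψ) ] φ)))
       × S (bs ∷ʳ (x , ψ)) (¬̇ φ)
       × S bs (∃̇ (cmp [ (x , ψ) ] (¬̇ φ)))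
       × S [] (γ bs (¬̇ (∀̇ (cmp [ (x , ψ) ] φ))))
       × S [] (γ bs (∃̇ (cmp [ (x , ψ) ] (¬̇ φ))))
       × (IsTrue (γ bs (¬̇ (∀̇ (cmp [ (x , ψ) ] φ))))
          → IsTrue (γ bs (∃̇ (cmp [ (x , ψ) ] (¬̇ φ)))))
lemma5p19 U Lg _ _ bs _ x ψ _ _ _ φ Sφ =
  S∀ , S¬∀ , S¬φ , S∃¬ , γ-S [] bs ¬∀ S¬∀ , γ-S [] bs ∃¬ S∃¬ , ¬∀-true⇒∃¬-true
  where
    open Framework U Lg
    open Development U Lg
    ¬∀ ∃¬ : Expr
    ¬∀ = ¬̇ (∀̇ (cmp [ (x , ψ) ] φ))
    ∃¬ = ∃̇ (cmp [ (x , ψ) ] (¬̇ φ))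
    S∀ : S bs (∀̇ (cmp [ (x , ψ) ] φ))
    S∀ = quantify-S ∀-quantifier bs x ψ φ Sφ
    S¬∀ : S bs ¬∀
    S¬∀ = negate-S (proj₁ S∀)
    S¬φ : S (bs ∷ʳ (x , ψ)) (¬̇ φ)
    S¬φ = negate-S (proj₁ Sφ)
    S∃¬ : S bs ∃¬
    S∃¬ = quantify-S ∃-quantifier bs x ψ (¬̇ φ) S¬φ
    -- Truth of the closures transfers by monotonicity of γ from ¬∀⇒∃¬.
    ¬∀-true⇒∃¬-true : IsTrue (γ bs ¬∀) → IsTrue (γ bs ∃¬)
    ¬∀-true⇒∃¬-true ¬∀-true =
      true-from-sem (proj₁ (γ-S [] bs ∃¬ S∃¬))
        (γ-monotone [] bs ¬∀ ∃¬ S¬∀ S∃¬ (¬∀⇒∃¬ bs x ψ φ Sφ (proj₁ S∃¬))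
                    [] refl (sem-from-true ¬∀-true))
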